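{- Let $N$ be a finite set of input clauses equipped with an arbitrary total order $\prec$ in which the start clauses are the least elements, and let every clause of a matrix inherit the position in $\prec$ of the input clause of which it is a copy. Let $M$ be a matrix, $\sigma$ a substitution and $\Gamma$ a spanning set of connections for $(M,\sigma)$. Let $D\in M$, and let $C$ be a variable-renamed copy of an input clause whose variables do not occur in any clause of $M$, with $D \succ C$. Suppose there is a substitution $\rho$ such that $\rho(C) = \sigma(D)$ (as sets of literals). Then the matrix $(M\setminus\{D\})\cup\{C\}$ also has a spanning set of connections, i.e. there exist a substitution $\sigma'$ and a spanning set of connections for $((M\setminus\{D\})\cup\{C\},\sigma')$.
   Context: Work in classical first-order logic. A clause is a finite set of literals (read as their disjunction). A matrix is a finite set of clauses whose variables are pairwise disjoint (each clause is a variable-renamed copy of an input clause). A single global substitution $\sigma$ is applied to the whole matrix. A literal occurrence of $M$ is a pair $(E,L)$ with $E\in M$, $L\in E$. A connection for $(M,\sigma)$ is an unordered pair $\{(E,L),(F,K)\}$ of literal occurrences with $E\neq F$ such that $\sigma(L)$ and $\sigma(K)$ have the same atom and opposite polarity; a set of connections is a set $\Gamma$ of such pairs. A path through $M$ is a set of literal occurrences containing exactly one occurrence from each clause of $M$; it is open with respect to $\Gamma$ if it contains no pair of $\Gamma$. $\Gamma$ is spanning if there is no open path through $M$. -}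

module Defs where

open import Data.Nat using (ℕ)
open import Data.Bool using (Bool; not)
open import Data.List using (List; []; _∷_; map)
open import Data.List.Membership.Propositional using (_∈_)
open import Data.List.Relation.Unary.Any using (Any)
open import Data.Product using (Σ; _×_; _,_; proj₁; proj₂; ∃)
open import Data.Sum using (_⊎_)
open import Relation.Nullary using (¬_)
open import Relation.Binary.PropositionalEquality using (_≡_; _≢_)
open import Function.Definitions using (Injective)

data Term : Set where
  var : ℕ → Term
  fn  : ℕ → List Term → Term

record Atom : Set where
  constructor atom
  field
    pred : ℕ
    args : List Term

-- A literal: polarity (true = positive) and an atom.
record Literal : Set where
  constructor lit
  field
    pol : Bool
    at  : Atom
open Literal public

-- A clause is a finite set of literals, represented by a list
-- (only membership is ever used, so the list is read as a set).
Clause : Set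
Clause = List Literal

-- A matrix: a finite set of clauses, again a list read via membership.
Matrix : Set
Matrix = List Clause

Subst : Set
Subst = ℕ → Term

mutual
  substT : Subst → Term → Term
  substT σ (var x)    = σ x
  substT σ (fn f ts)  = fn f (substTs σ ts)

  substTs : Subst → List Term → List Term
  substTs σ []       = []
  substTs σ (t ∷ ts) = substT σ t ∷ substTs σ ts

substA : Subst → Atom → Atom
substA σ (atom p ts) = atom p (substTs σ ts)

substL : Subst → Literal → Literal
substL σ (lit b a) = lit b (substA σ a)

substC : Subst → Clause → Clause
substC σ E = map (substL σ) E

renL : (ℕ → ℕ) → Literal → Literal
renL r = substL (λ x → var (r x))

mutual
  data OccT (x : ℕ) : Term → Set where
    here : OccT x (var x)
    inFn : ∀ {f ts} → OccTs x ts → OccT x (fn f ts)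

  data OccTs (x : ℕ) : List Term → Set where
    hd : ∀ {t ts} → OccT x t → OccTs x (t ∷ ts)
    tl : ∀ {t ts} → OccTs x ts → OccTs x (t ∷ ts)

OccL : ℕ → Literal → Set
OccL x (lit b (atom p ts)) = OccTs x ts

OccC : ℕ → Clause → Set
OccC x E = Σ Literal λ L → L ∈ E × OccL x L

_≈C_ : Clause → Clause → Set
E ≈C F = (∀ L → L ∈ E → L ∈ F) × (∀ L → L ∈ F → L ∈ E)

IsCopy : Clause → Clause → Set
IsCopy E I = Σ (ℕ → ℕ) λ r → Injective _≡_ _≡_ r × (E ≈C map (renL r) I)

record InputOrder (N : List Clause) (Start : Clause → Set)
                  (_≺_ : Clause → Clause → Set) : Set where
  field
    startIn   : ∀ I → Start I → I ∈ N
    irrefl    : ∀ I → I ∈ N → ¬ (I ≺ I)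
    trans     : ∀ I J K → I ∈ N → J ∈ N → K ∈ N → I ≺ J → J ≺ K → I ≺ K
    total     : ∀ I J → I ∈ N → J ∈ N → (I ≺ J) ⊎ ((I ≡ J) ⊎ (J ≺ I))
    startLeast : ∀ I J → I ∈ N → J ∈ N → Start I → ¬ Start J → I ≺ J

-- M is a matrix over the input clauses N: every clause is a
-- variable-renamed copy of the input clause orig E ∈ N (whose position
-- in ≺ it inherits), and distinct clauses have disjoint variables.
record IsMatrix (N : List Clause) (orig : Clause → Clause) (M : Matrix) : Set where
  field
    origIn   : ∀ E → E ∈ M → orig E ∈ N
    isCopy   : ∀ E → E ∈ M → IsCopy E (orig E)
    disjoint : ∀ E F → E ∈ M → F ∈ M → E ≢ F → ∀ x → OccC x E → ¬ OccC x F

Occ : Set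
Occ = Clause × Literal

Complementary : Subst → Literal → Literal → Set
Complementary σ L K =
  (at (substL σ L) ≡ at (substL σ K)) × (pol K ≡ not (pol L))

IsConnection : Matrix → Subst → Occ → Occ → Set
IsConnection M σ (E , L) (F , K) =
  E ∈ M × L ∈ E × F ∈ M × K ∈ F × E ≢ F × Complementary σ L K

-- A set of connections: finite list of (unordered) pairs, all connections.
-- (Each entry (x , y) stands for the unordered pair {x , y}.)
Connections : Set
Connections = List (Occ × Occ)

IsConnectionSet : Matrix → Subst → Connections → Set
IsConnectionSet M σ Γ = ∀ x y → (x , y) ∈ Γ → IsConnection M σ x y

IsPath : Matrix → (Clause → Literal) → Set
IsPath M p = ∀ E → E ∈ M → p E ∈ E

PathHas : Matrix → (Clause → Literal) → Occ → Set
PathHas M p (E , L) = E ∈ M × p E ≡ L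

IsOpen : Matrix → (Clause → Literal) → Connections → Set
IsOpen M p Γ = ∀ x y → (x , y) ∈ Γ → ¬ (PathHas M p x × PathHas M p y)

Spanning : Matrix → Connections → Set
Spanning M Γ = ¬ (Σ (Clause → Literal) λ p → IsPath M p × IsOpen M p Γ)

HasSpanning : Matrix → Set
HasSpanning M = Σ Subst λ σ' → Σ Connections λ Γ' →
  IsConnectionSet M σ' Γ' × Spanning M Γ'

{-# OPTIONS --safe #-}

-- Take σ′ to be ρ on the (fresh) variables of C and σ elsewhere, and take all
-- connections of M′ under σ′. A path p′ through M′ avoiding them yields a path p
-- through M: keep p′ off D and choose in D a literal L with σ L = ρ (p′ C), which
-- exists because ρ C = σ D. Clause by clause, p under σ has the same instances as
-- p′ under σ′, so a connection on p would be a connection on p′, or, if both of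
-- its clauses correspond to the same clause of M′, a pair of complementary
-- literals with equal instances. Since Γ spans M, no such p′ exists.

module Submission where

open import Defs
open import Data.Bool using (not)
open import Data.Bool.Properties using (not-¬) renaming (_≟_ to _≟B_)
open import Data.List using (List; []; _∷_; map; concatMap; filter; cartesianProduct)
open import Data.List.Membership.Propositional using (_∈_; find; lose)
open import Data.List.Membership.Propositional.Properties
  using (∈-map⁺; ∈-map⁻; ∈-concatMap⁺; ∈-filter⁺; ∈-filter⁻; ∈-cartesianProduct⁺)
open import Data.List.Relation.Unary.Any using (any?)
import Data.List.Relation.Unary.Any as Any
open import Data.List.Properties using (≡-dec)
open import Data.Nat using () renaming (_≟_ to _≟ℕ_)
open import Data.Product using (Σ; _×_; _,_; proj₁; proj₂)
open import Data.Sum using (_⊎_; inj₁; inj₂; [_,_]′)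
open import Relation.Binary.Definitions using (DecidableEquality)
open import Relation.Binary.PropositionalEquality
  using (_≡_; _≢_; refl; sym; trans; cong; cong₂; module ≡-Reasoning)
open import Relation.Nullary using (¬_; Dec; yes; no)
open import Relation.Nullary.Decidable using (map′; _×-dec_; _⊎-dec_; ¬?)
open import Relation.Nullary.Negation using (contradiction)

mutual
  _≟T_ : DecidableEquality Term
  var x   ≟T var y   = map′ (λ { refl → refl }) (λ { refl → refl }) (x ≟ℕ y)
  var _   ≟T fn _ _  = no λ ()
  fn _ _  ≟T var _   = no λ ()
  fn f ts ≟T fn g us =
    map′ (λ { (refl , refl) → refl }) (λ { refl → refl , refl }) (f ≟ℕ g ×-dec ts ≟Ts us)

  _≟Ts_ : DecidableEquality (List Term)
  []       ≟Ts []       = yes refl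
  []       ≟Ts (_ ∷ _)  = no λ ()
  (_ ∷ _)  ≟Ts []       = no λ ()
  (t ∷ ts) ≟Ts (u ∷ us) =
    map′ (λ { (refl , refl) → refl }) (λ { refl → refl , refl }) (t ≟T u ×-dec ts ≟Ts us)

_≟A_ : DecidableEquality Atom
atom p ts ≟A atom q us =
  map′ (λ { (refl , refl) → refl }) (λ { refl → refl , refl }) (p ≟ℕ q ×-dec ts ≟Ts us)

_≟L_ : DecidableEquality Literal
lit b a ≟L lit c a′ =
  map′ (λ { (refl , refl) → refl }) (λ { refl → refl , refl }) (b ≟B c ×-dec a ≟A a′)

_≟C_ : DecidableEquality Clause
_≟C_ = ≡-dec _≟L_

mutual
  occT? : ∀ x t → Dec (OccT x t)
  occT? x (var y)   = map′ (λ { refl → here }) (λ { here → refl }) (x ≟ℕ y)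
  occT? x (fn f ts) = map′ inFn (λ { (inFn o) → o }) (occTs? x ts)

  occTs? : ∀ x ts → Dec (OccTs x ts)
  occTs? x []       = no λ ()
  occTs? x (t ∷ ts) =
    map′ [ hd , tl ]′ (λ { (hd o) → inj₁ o ; (tl o) → inj₂ o }) (occT? x t ⊎-dec occTs? x ts)

occL? : ∀ x L → Dec (OccL x L)
occL? x (lit b (atom p ts)) = occTs? x ts

occC? : ∀ x E → Dec (OccC x E)
occC? x E = map′ find (λ (_ , L∈E , o) → lose L∈E o) (any? (occL? x) E)

mutual
  substT-agree : ∀ σ τ t → (∀ x → OccT x t → σ x ≡ τ x) → substT σ t ≡ substT τ t
  substT-agree σ τ (var x)   agree = agree x here
  substT-agree σ τ (fn f ts) agree =
    cong (fn f) (substTs-agree σ τ ts (λ x o → agree x (inFn o)))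

  substTs-agree : ∀ σ τ ts → (∀ x → OccTs x ts → σ x ≡ τ x) → substTs σ ts ≡ substTs τ ts
  substTs-agree σ τ []       agree = refl
  substTs-agree σ τ (t ∷ ts) agree = cong₂ _∷_
    (substT-agree σ τ t (λ x o → agree x (hd o)))
    (substTs-agree σ τ ts (λ x o → agree x (tl o)))

substL-agree : ∀ σ τ L → (∀ x → OccL x L → σ x ≡ τ x) → substL σ L ≡ substL τ L
substL-agree σ τ (lit b (atom p ts)) agree =
  cong (λ us → lit b (atom p us)) (substTs-agree σ τ ts agree)

overrideOn : Clause → Subst → Subst → Subst
overrideOn C ρ σ x with occC? x C
... | yes _ = ρ x
... | no  _ = σ x

module _ (C : Clause) (ρ σ : Subst) where

  overrideOn-inside : ∀ {L} → L ∈ C → substL (overrideOn C ρ σ) L ≡ substL ρ L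
  overrideOn-inside {L} L∈C = substL-agree _ _ L onC
    where
    onC : ∀ x → OccL x L → overrideOn C ρ σ x ≡ ρ x
    onC x o with occC? x C
    ... | yes _ = refl
    ... | no x∉C = contradiction (L , L∈C , o) x∉C

  overrideOn-outside : ∀ {L} → (∀ x → OccL x L → ¬ OccC x C) →
                       substL (overrideOn C ρ σ) L ≡ substL σ L
  overrideOn-outside {L} outside = substL-agree _ _ L offC
    where
    offC : ∀ x → OccL x L → overrideOn C ρ σ x ≡ σ x
    offC x o with occC? x C
    ... | yes x∈C = contradiction x∈C (outside x o)
    ... | no _ = refl

complementary-transport : ∀ {σ σ′ L K L′ K′} →
  substL σ′ L′ ≡ substL σ L → substL σ′ K′ ≡ substL σ K →
  Complementary σ L K → Complementary σ′ L′ K′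
complementary-transport eqL eqK (atoms , pols) =
  trans (cong at eqL) (trans atoms (cong at (sym eqK))) ,
  trans (cong pol eqK) (trans pols (cong not (sym (cong pol eqL))))

complementary-irreflexive : ∀ {σ L K} → substL σ L ≡ substL σ K → ¬ Complementary σ L K
complementary-irreflexive eq (_ , pols) = not-¬ (sym (cong pol eq)) pols

occurrencesIn : Clause → List Occ
occurrencesIn E = map (E ,_) E

occurrences : Matrix → List Occ
occurrences = concatMap occurrencesIn

∈-occurrences : ∀ {M E L} → E ∈ M → L ∈ E → (E , L) ∈ occurrences M
∈-occurrences E∈M L∈E = ∈-concatMap⁺ occurrencesIn (Any.map (λ { refl → ∈-map⁺ _ L∈E }) E∈M)

isConnection? : ∀ M σ (xy : Occ × Occ) → Dec (IsConnection M σ (proj₁ xy) (proj₂ xy))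
isConnection? M σ ((E , L) , (F , K)) =
  any? (E ≟C_) M ×-dec any? (L ≟L_) E ×-dec any? (F ≟C_) M ×-dec any? (K ≟L_) F ×-dec
  ¬? (E ≟C F) ×-dec (at (substL σ L) ≟A at (substL σ K) ×-dec pol K ≟B not (pol L))

allConnections : Matrix → Subst → Connections
allConnections M σ =
  filter (isConnection? M σ) (cartesianProduct (occurrences M) (occurrences M))

allConnections-isConnectionSet : ∀ M σ → IsConnectionSet M σ (allConnections M σ)
allConnections-isConnectionSet M σ x y xy∈ =
  proj₂ (∈-filter⁻ (isConnection? M σ) {xs = cartesianProduct (occurrences M) (occurrences M)} xy∈)

∈-allConnections : ∀ {M σ x y} → IsConnection M σ x y → (x , y) ∈ allConnections M σ
∈-allConnections {M} {σ} c@(E∈M , L∈E , F∈M , K∈F , _) =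
  ∈-filter⁺ (isConnection? M σ)
    (∈-cartesianProduct⁺ (∈-occurrences E∈M L∈E) (∈-occurrences F∈M K∈F)) c

ConnectionFree : Matrix → Subst → (Clause → Literal) → Set
ConnectionFree M σ p = ∀ x y → IsConnection M σ x y → ¬ (PathHas M p x × PathHas M p y)

spanning⇒¬connectionFree : ∀ {M σ Γ p} → IsConnectionSet M σ Γ → Spanning M Γ →
  IsPath M p → ¬ ConnectionFree M σ p
spanning⇒¬connectionFree {p = p} isConn spanning path free =
  spanning (p , path , λ x y xy∈Γ → free x y (isConn x y xy∈Γ))

allConnections-spanning : ∀ {M σ} → (∀ p → IsPath M p → ¬ ConnectionFree M σ p) →
  Spanning M (allConnections M σ)
allConnections-spanning noFree (p , path , isOpen) =
  noFree p path (λ x y c → isOpen x y (∈-allConnections c))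

module _ {M M′ : Matrix} {σ σ′ : Subst} {p p′ : Clause → Literal}
         (τ : Clause → Clause) (τ-into : ∀ {E} → E ∈ M → τ E ∈ M′)
         (sameInstance : ∀ {E} → E ∈ M → substL σ′ (p′ (τ E)) ≡ substL σ (p E)) where

  -- τ need not be injective on M (in the application C may itself be a clause of M).
  connectionFree-pullback : IsPath M′ p′ → ConnectionFree M′ σ′ p′ → ConnectionFree M σ p
  connectionFree-pullback path′ free′ (E , _) (F , _) (E∈M , _ , F∈M , _ , _ , comp)
                          ((_ , refl) , (_ , refl)) with τ E ≟C τ F
  ... | yes τE≡τF = complementary-irreflexive σpE≡σpF comp
    where
    open ≡-Reasoning
    σpE≡σpF : substL σ (p E) ≡ substL σ (p F)
    σpE≡σpF = begin
      substL σ (p E)        ≡⟨ sym (sameInstance E∈M) ⟩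
      substL σ′ (p′ (τ E))  ≡⟨ cong (λ X → substL σ′ (p′ X)) τE≡τF ⟩
      substL σ′ (p′ (τ F))  ≡⟨ sameInstance F∈M ⟩
      substL σ (p F)        ∎
  ... | no τE≢τF =
    free′ (τ E , p′ (τ E)) (τ F , p′ (τ F)) connection ((τ-into E∈M , refl) , (τ-into F∈M , refl))
    where
    connection : IsConnection M′ σ′ (τ E , p′ (τ E)) (τ F , p′ (τ F))
    connection = τ-into E∈M , path′ _ (τ-into E∈M) , τ-into F∈M , path′ _ (τ-into F∈M) ,
                 τE≢τF , complementary-transport (sameInstance E∈M) (sameInstance F∈M) comp

≈C-partner : ∀ {ρ σ C D K} → substC ρ C ≈C substC σ D → K ∈ C →
  Σ Literal λ L → L ∈ D × substL ρ K ≡ substL σ L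
≈C-partner {ρ} {σ} (C⊆D , _) K∈C = ∈-map⁻ (substL σ) (C⊆D _ (∈-map⁺ (substL ρ) K∈C))

module ClauseReplacement {M M′ : Matrix} {σ ρ : Subst} {D C : Clause}
  (fresh : ∀ x → OccC x C → ∀ E → E ∈ M → ¬ OccC x E)
  (ρC≈σD : substC ρ C ≈C substC σ D)
  (M′⊇ : ∀ X → (X ∈ M × X ≢ D) ⊎ X ≡ C → X ∈ M′) where

  σ′ : Subst
  σ′ = overrideOn C ρ σ

  σ′-onM : ∀ {E L} → E ∈ M → L ∈ E → substL σ′ L ≡ substL σ L
  σ′-onM E∈M L∈E = overrideOn-outside C ρ σ (λ x o x∈C → fresh x x∈C _ E∈M (_ , L∈E , o))

  C∈M′ : C ∈ M′
  C∈M′ = M′⊇ C (inj₂ refl)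

  τ : Clause → Clause
  τ E with E ≟C D
  ... | yes _ = C
  ... | no  _ = E

  τ-into : ∀ {E} → E ∈ M → τ E ∈ M′
  τ-into {E} E∈M with E ≟C D
  ... | yes _   = C∈M′
  ... | no  E≢D = M′⊇ E (inj₁ (E∈M , E≢D))

  module _ {p′ : Clause → Literal} (path′ : IsPath M′ p′) where

    partner : Σ Literal λ L → L ∈ D × substL ρ (p′ C) ≡ substL σ L
    partner = ≈C-partner ρC≈σD (path′ C C∈M′)

    p : Clause → Literal
    p E with E ≟C D
    ... | yes _ = proj₁ partner
    ... | no  _ = p′ E

    path : IsPath M p
    path E E∈M with E ≟C D
    ... | yes refl = proj₁ (proj₂ partner)
    ... | no  E≢D  = path′ E (M′⊇ E (inj₁ (E∈M , E≢D)))

    sameInstance : ∀ {E} → E ∈ M → substL σ′ (p′ (τ E)) ≡ substL σ (p E)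
    sameInstance {E} E∈M with E ≟C D
    ... | yes refl = trans (overrideOn-inside C ρ σ (path′ C C∈M′)) (proj₂ (proj₂ partner))
    ... | no  E≢D  = σ′-onM E∈M (path′ E (M′⊇ E (inj₁ (E∈M , E≢D))))

mainTheorem2 : (N : List Clause) (Start : Clause → Set) (_≺_ : Clause → Clause → Set) →
    InputOrder N Start _≺_ →
    (orig : Clause → Clause) (M : Matrix) → IsMatrix N orig M →
    (σ : Subst) (Γ : Connections) → IsConnectionSet M σ Γ → Spanning M Γ →
    (D : Clause) → D ∈ M →
    (C IC : Clause) → IC ∈ N → IsCopy C IC →
    (∀ x → OccC x C → ∀ E → E ∈ M → ¬ OccC x E) →
    IC ≺ orig D →
    (ρ : Subst) → substC ρ C ≈C substC σ D →
    (M' : Matrix) → (∀ X → X ∈ M' → (X ∈ M × X ≢ D) ⊎ X ≡ C) →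
    (∀ X → (X ∈ M × X ≢ D) ⊎ X ≡ C → X ∈ M') →
    HasSpanning M'
-- Only the freshness of C, ρ C = σ D and (M ∖ {D}) ∪ {C} ⊆ M′ are used: the order ≺
-- and the copy structure matter for the calculus, not for spanning.
mainTheorem2 _ _ _ _ _ _ _ _ _ isConn spanning _ _ _ _ _ _ fresh _ _ ρC≈σD M′ _ M′⊇ =
  σ′ , allConnections M′ σ′ , allConnections-isConnectionSet M′ σ′ ,
  allConnections-spanning λ p′ path′ free′ →
    spanning⇒¬connectionFree isConn spanning (path path′)
      (connectionFree-pullback τ τ-into (sameInstance path′) path′ free′)
  where open ClauseReplacement fresh ρC≈σD M′⊇
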